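{- The $6$-cycle $C_6$ is an ABCE$_2$-graph: the median function is the unique consensus function on $C_6$ satisfying the axioms (A), (B), (C), (E$_2$).
   Context: $C_6$ has vertices $v_0,\dots,v_5$, $v_i\sim v_{i\pm1}$ (indices mod 6), with distance $d$ and intervals $I(u,v)=\{w:d(u,w)+d(w,v)=d(u,v)\}$. A profile is a finite sequence of vertices (repetitions allowed), $V^*$ the set of profiles, $\pi\rho$ concatenation; a consensus function is a map $L:V^*\to 2^V\setminus\{\emptyset\}$; the median function maps $\pi$ to the set of minimizers of $F_\pi(v)=\sum_{x\in\pi}d(v,x)$. Three vertices $u,v,w$ form a metric triangle if $I(u,v)\cap I(u,w)=\{u\}$, $I(v,u)\cap I(v,w)=\{v\}$, $I(w,u)\cap I(w,v)=\{w\}$; it is equilateral of size $k$ if all three pairwise distances equal $k$. Axioms: (A) invariance under permutations of the profile; (B) $L(u,v)=I(u,v)$; (C) if $L(\pi)\cap L(\rho)\neq\emptyset$ then $L(\pi\rho)=L(\pi)\cap L(\rho)$; (E$_2$) for every equilateral metric triangle $uvw$ of size 2, if $u\in L(u,v,w)$ then $\{u,v,w\}\subseteq L(u,v,w)$. -}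

module Defs where

open import Data.Nat using (ℕ; _+_; _∸_; _≤_; _≤?_; _⊓_)
open import Data.Nat.Properties using (_≟_)
open import Data.Fin using (Fin; toℕ)
open import Data.Fin.Subset using (Subset; _∈_; _∩_; ⁅_⁆; Nonempty)
open import Data.Fin.Subset.Properties using ()
open import Data.Vec using (tabulate)
open import Data.List using (List; []; _∷_; _++_; map)
open import Data.Nat.ListAction using (sum)
open import Data.List.Relation.Binary.Permutation.Propositional using (_↭_)
open import Data.Fin.Properties using (all?)
open import Data.Bool using (Bool; if_then_else_)
open import Data.Product using (_×_)
open import Relation.Binary.PropositionalEquality using (_≡_)
open import Relation.Nullary.Decidable using (does)
open import Data.Fin.Subset using (Side; inside; outside)

V : Set
V = Fin 6

absDiff : ℕ → ℕ → ℕ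
absDiff a b = (a ∸ b) + (b ∸ a)

d : V → V → ℕ
d u v = absDiff (toℕ u) (toℕ v) ⊓ (6 ∸ absDiff (toℕ u) (toℕ v))

toSide : Bool → Side
toSide b = if b then inside else outside

I : V → V → Subset 6
I u v = tabulate (λ w → toSide (does (d u w + d w v ≟ d u v)))

Profile : Set
Profile = List V

ConsensusFn : Set
ConsensusFn = Profile → Subset 6

IsConsensus : ConsensusFn → Set
IsConsensus L = ∀ π → Nonempty (L π)

F : Profile → V → ℕ
F π v = sum (map (d v) π)

Med : ConsensusFn
Med π = tabulate (λ w → toSide (does (all? (λ v → F π w ≤? F π v))))

MetricTriangle : V → V → V → Set
MetricTriangle u v w =
  (I u v ∩ I u w ≡ ⁅ u ⁆) × (I v u ∩ I v w ≡ ⁅ v ⁆) × (I w u ∩ I w v ≡ ⁅ w ⁆)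

EquilateralMetricTriangle : ℕ → V → V → V → Set
EquilateralMetricTriangle k u v w =
  MetricTriangle u v w × (d u v ≡ k) × (d v w ≡ k) × (d u w ≡ k)

AxiomA : ConsensusFn → Set
AxiomA L = ∀ π ρ → π ↭ ρ → L π ≡ L ρ

AxiomB : ConsensusFn → Set
AxiomB L = ∀ u v → L (u ∷ v ∷ []) ≡ I u v

AxiomC : ConsensusFn → Set
AxiomC L = ∀ π ρ → Nonempty (L π ∩ L ρ) → L (π ++ ρ) ≡ L π ∩ L ρ

AxiomE₂ : ConsensusFn → Set
AxiomE₂ L = ∀ u v w → EquilateralMetricTriangle 2 u v w →
  u ∈ L (u ∷ v ∷ w ∷ []) →
  (u ∈ L (u ∷ v ∷ w ∷ [])) × (v ∈ L (u ∷ v ∷ w ∷ [])) × (w ∈ L (u ∷ v ∷ w ∷ []))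

ABCE₂ : ConsensusFn → Set
ABCE₂ L = AxiomA L × AxiomB L × AxiomC L × AxiomE₂ L

-- The median function satisfies (A) and (C) because F is additive over
-- concatenation and invariant under permutation, and (B) and (E₂) by direct
-- computation on C₆.
--
-- Conversely, let L satisfy the axioms. By (B) and (C) it agrees with the
-- median function on the empty profile, on single vertices and on pairs. Let
-- T = u v w be an equilateral triangle and y a vertex off T; rotating T by (A)
-- we may assume w antipodal to y. Then T y splits into the pairs u v and w y,
-- whose values I u v and V both contain u, so y ∈ L T would give
-- u ∈ L (T y) = L T ∩ ⁅ y ⁆. Hence L T ⊆ T, and (E₂) gives L T = T.
-- Call such singletons, pairs and triangles basic. An exhaustive search shows
-- that every nonempty X ⊆ V contains a basic σ of distinct vertices such that
-- every vertex m is dominated on X by the midpoint of a median of σ and some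
-- other vertex. For a profile π with support X this makes Med σ meet the
-- median set of the remainder τ of π, and (A), (C) and induction on the length
-- give L π = Med π.

module Submission where

open import Defs
open import Data.Bool.Properties using () renaming (_≟_ to _≟ᵇ_)
open import Data.Empty using (⊥-elim)
open import Data.Fin using (Fin; zero; suc; #_; toℕ) renaming (_≟_ to _≟ᶠ_)
open import Data.Fin.Properties using (all?; any?)
open import Data.Fin.Subset
  using (Subset; _∈_; _∉_; _∩_; _∪_; ⁅_⁆; ⊤; Nonempty; _⊆_; inside)
open import Data.Fin.Subset.Properties
  using (_∈?_; nonempty?; anySubset?; ⊆-antisym; ∈⊤; x∈⁅x⁆; x∈⁅y⁆⇒x≡y;
         x∈p∩q⁺; x∈p∩q⁻; x∈p∪q⁺; x∈p∪q⁻; ∩-idem; ∩-identityʳ)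
open import Data.List using (List; []; _∷_; [_]; _++_; map; length; allFin; cartesianProduct)
open import Data.List.Extrema.Nat using (argmin; f[argmin]≤f[xs])
open import Data.List.Membership.Propositional using () renaming (_∈_ to _∈ˡ_)
open import Data.List.Membership.Propositional.Properties using (∈-allFin; ∈-∃++; ∈-++⁺ʳ)
open import Data.List.Membership.DecPropositional (_≟ᶠ_ {6}) using () renaming (_∈?_ to _∈ˡ?_)
open import Data.List.Properties using (map-++; length-++)
open import Data.List.Relation.Binary.Permutation.Propositional using (_↭_; ↭-refl; ↭-sym; ↭-trans; prep)
open import Data.List.Relation.Binary.Permutation.Propositional.Properties
  using (shift; ∈-resp-↭; ↭-length; map⁺)
open import Data.List.Relation.Unary.All as All using (All; []; _∷_)
open import Data.List.Relation.Unary.AllPairs using (_∷_)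
open import Data.List.Relation.Unary.Any using (here; there; satisfied)
import Data.List.Relation.Unary.Any as Any
open import Data.List.Relation.Unary.Unique.Propositional using (Unique)
open import Data.List.Relation.Unary.Unique.DecPropositional (_≟ᶠ_ {6}) using (unique?)
open import Data.Nat using (_+_; _*_; _≤_; _<_; _≤?_; _≟_; s≤s; z≤n)
open import Data.Nat.Induction using (<-wellFounded)
open import Data.Nat.ListAction using (sum)
open import Data.Nat.ListAction.Properties using (sum-++; sum-↭)
open import Data.Nat.Properties
  using (≤-trans; +-mono-≤; +-monoˡ-≤; +-monoʳ-≤; +-cancelˡ-≤; +-cancelʳ-≤; +-identityʳ; *-distribˡ-+;
         m<n+m; n∸n≡0; +-commutativeSemigroup; module ≤-Reasoning)
open import Algebra.Properties.CommutativeSemigroup +-commutativeSemigroup using (interchange)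
open import Data.Product using (∃; ∃₂; _×_; _,_; proj₁; proj₂; -,_)
open import Data.Sum using (_⊎_; inj₁; inj₂)
open import Data.Vec using (tabulate)
open import Data.Vec.Properties using (lookup∘tabulate; []=⇒lookup; lookup⇒[]=; ≡-dec)
open import Function using (_∘_; _on_)
open import Induction.WellFounded using (Acc; acc)
open import Relation.Binary.Construct.On using () renaming (wellFounded to on-wellFounded)
open import Relation.Binary.PropositionalEquality
  using (_≡_; _≢_; refl; sym; trans; cong; cong₂; subst; subst₂; module ≡-Reasoning)
open import Relation.Nullary using (Dec; yes; no; ¬_; does; ¬?)
open import Relation.Nullary.Decidable using (toWitness; from-no; decidable-stable; _×-dec_; _→-dec_)

toSide-does⁺ : ∀ {P : Set} (P? : Dec P) → P → toSide (does P?) ≡ inside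
toSide-does⁺ (yes _) _ = refl
toSide-does⁺ (no ¬p) p = ⊥-elim (¬p p)

toSide-does⁻ : ∀ {P : Set} (P? : Dec P) → toSide (does P?) ≡ inside → P
toSide-does⁻ (yes p) _ = p

∈-decided⁺ : ∀ {n} {P : Fin n → Set} (P? : ∀ w → Dec (P w)) {w} →
             P w → w ∈ tabulate (λ w → toSide (does (P? w)))
∈-decided⁺ P? {w} p =
  lookup⇒[]= w _ (trans (lookup∘tabulate (λ w → toSide (does (P? w))) w) (toSide-does⁺ (P? w) p))

∈-decided⁻ : ∀ {n} {P : Fin n → Set} (P? : ∀ w → Dec (P w)) {w} →
             w ∈ tabulate (λ w → toSide (does (P? w))) → P w
∈-decided⁻ P? {w} w∈ =
  toSide-does⁻ (P? w) (trans (sym (lookup∘tabulate (λ w → toSide (does (P? w))) w)) ([]=⇒lookup w∈))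

d-refl : ∀ u → d u u ≡ 0
d-refl u rewrite n∸n≡0 (toℕ u) = refl

∈-I-left : ∀ u v → u ∈ I u v
∈-I-left u v = ∈-decided⁺ (λ w → d u w + d w v ≟ d u v) (cong (_+ d u v) (d-refl u))

I-refl : ∀ u → I u u ≡ ⁅ u ⁆
I-refl zero = refl
I-refl (suc zero) = refl
I-refl (suc (suc zero)) = refl
I-refl (suc (suc (suc zero))) = refl
I-refl (suc (suc (suc (suc zero)))) = refl
I-refl (suc (suc (suc (suc (suc zero))))) = refl

IsMedian : Profile → V → Set
IsMedian π w = ∀ v → F π w ≤ F π v

∈Med⁺ : ∀ π {w} → IsMedian π w → w ∈ Med π
∈Med⁺ π = ∈-decided⁺ (λ w → all? (λ v → F π w ≤? F π v))

∈Med⁻ : ∀ π {w} → w ∈ Med π → IsMedian π w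
∈Med⁻ π = ∈-decided⁻ (λ w → all? (λ v → F π w ≤? F π v))

Med-nonempty : IsConsensus Med
Med-nonempty π = argmin (F π) zero (allFin 6) , ∈Med⁺ π minimal
  where
  minimal : IsMedian π (argmin (F π) zero (allFin 6))
  minimal v = All.lookup (f[argmin]≤f[xs] {f = F π} zero (allFin 6)) (∈-allFin v)

F-++ : ∀ π ρ v → F (π ++ ρ) v ≡ F π v + F ρ v
F-++ π ρ v = trans (cong sum (map-++ (d v) π ρ)) (sum-++ (map (d v) π) (map (d v) ρ))

F-↭ : ∀ {π ρ} → π ↭ ρ → ∀ v → F π v ≡ F ρ v
F-↭ p v = sum-↭ (map⁺ (d v) p)

Med-↭ : ∀ {π ρ} → π ↭ ρ → Med π ⊆ Med ρ
Med-↭ {π} {ρ} p {w} w∈ = ∈Med⁺ ρ (λ v → subst₂ _≤_ (F-↭ p w) (F-↭ p v) (∈Med⁻ π w∈ v))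

Med-A : AxiomA Med
Med-A π ρ p = ⊆-antisym (Med-↭ p) (Med-↭ (↭-sym p))

+-squeeze-≤ : ∀ {a b c e} → c ≤ a → e ≤ b → a + b ≤ c + e → a ≤ c × b ≤ e
+-squeeze-≤ {a} {b} {c} {e} c≤a e≤b a+b≤c+e =
  +-cancelʳ-≤ b a c (≤-trans a+b≤c+e (+-monoʳ-≤ c e≤b)) ,
  +-cancelˡ-≤ a b e (≤-trans a+b≤c+e (+-monoˡ-≤ e c≤a))

Med-C : AxiomC Med
Med-C π ρ (m , m∈) = ⊆-antisym split join
  where
  m-median-π : IsMedian π m
  m-median-π = ∈Med⁻ π (proj₁ (x∈p∩q⁻ (Med π) (Med ρ) m∈))
  m-median-ρ : IsMedian ρ m
  m-median-ρ = ∈Med⁻ ρ (proj₂ (x∈p∩q⁻ (Med π) (Med ρ) m∈))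

  split : Med (π ++ ρ) ⊆ Med π ∩ Med ρ
  split {w} w∈ = x∈p∩q⁺ (∈Med⁺ π (λ v → ≤-trans (proj₁ tight) (m-median-π v)) ,
                         ∈Med⁺ ρ (λ v → ≤-trans (proj₂ tight) (m-median-ρ v)))
    where
    tight : F π w ≤ F π m × F ρ w ≤ F ρ m
    tight = +-squeeze-≤ (m-median-π w) (m-median-ρ w)
              (subst₂ _≤_ (F-++ π ρ w) (F-++ π ρ m) (∈Med⁻ (π ++ ρ) w∈ m))

  join : Med π ∩ Med ρ ⊆ Med (π ++ ρ)
  join {w} w∈ with x∈p∩q⁻ (Med π) (Med ρ) w∈
  ... | w∈π , w∈ρ = ∈Med⁺ (π ++ ρ) λ v →
    subst₂ _≤_ (sym (F-++ π ρ w)) (sym (F-++ π ρ v)) (+-mono-≤ (∈Med⁻ π w∈π v) (∈Med⁻ ρ w∈ρ v))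

Med-B : AxiomB Med
Med-B = toWitness {a? = all? λ u → all? λ v → ≡-dec _≟ᵇ_ (Med (u ∷ v ∷ [])) (I u v)} _

Med-equilateral₂ : ∀ u v w → d u v ≡ 2 × d v w ≡ 2 × d u w ≡ 2 →
  u ∈ Med (u ∷ v ∷ w ∷ []) × v ∈ Med (u ∷ v ∷ w ∷ []) × w ∈ Med (u ∷ v ∷ w ∷ [])
Med-equilateral₂ = toWitness {a? = all? λ u → all? λ v → all? λ w →
  ((d u v ≟ 2) ×-dec (d v w ≟ 2) ×-dec (d u w ≟ 2)) →-dec
  ((u ∈? Med (u ∷ v ∷ w ∷ [])) ×-dec (v ∈? Med (u ∷ v ∷ w ∷ [])) ×-dec (w ∈? Med (u ∷ v ∷ w ∷ [])))} _

Med-E₂ : AxiomE₂ Med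
Med-E₂ u v w (_ , distances) _ = Med-equilateral₂ u v w distances

Med-ABCE₂ : ABCE₂ Med
Med-ABCE₂ = Med-A , Med-B , Med-C , Med-E₂

pattern equilateral = (refl , refl , refl) , refl , refl , refl

corners : V → V → V → Subset 6
corners u v w = ⁅ u ⁆ ∪ ⁅ v ⁆ ∪ ⁅ w ⁆

module Consequences (L : ConsensusFn) (L-nonempty : IsConsensus L) (axioms : ABCE₂ L) where

  A : AxiomA L
  A = proj₁ axioms
  B : AxiomB L
  B = proj₁ (proj₂ axioms)
  C : AxiomC L
  C = proj₁ (proj₂ (proj₂ axioms))
  E₂ : AxiomE₂ L
  E₂ = proj₂ (proj₂ (proj₂ axioms))

  L-++ : ∀ {π ρ x} → x ∈ L π → x ∈ L ρ → L (π ++ ρ) ≡ L π ∩ L ρ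
  L-++ x∈π x∈ρ = C _ _ (_ , x∈p∩q⁺ (x∈π , x∈ρ))

  ∈-L-++ : ∀ {π ρ x} → x ∈ L π → x ∈ L ρ → x ∈ L (π ++ ρ)
  ∈-L-++ x∈π x∈ρ = subst (_ ∈_) (sym (L-++ x∈π x∈ρ)) (x∈p∩q⁺ (x∈π , x∈ρ))

  L-[] : L [] ≡ ⊤
  L-[] = begin
    L []                       ≡⟨ sym (∩-identityʳ (L [])) ⟩
    L [] ∩ ⊤                   ≡⟨ cong (L [] ∩_) (sym antipodal) ⟩
    L [] ∩ L (# 0 ∷ # 3 ∷ [])  ≡⟨ sym (L-++ x∈[] (subst (_ ∈_) (sym antipodal) ∈⊤)) ⟩
    L (# 0 ∷ # 3 ∷ [])         ≡⟨ antipodal ⟩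
    ⊤                          ∎
    where
    open ≡-Reasoning
    antipodal : L (# 0 ∷ # 3 ∷ []) ≡ ⊤
    antipodal = B (# 0) (# 3)
    x∈[] : proj₁ (L-nonempty []) ∈ L []
    x∈[] = proj₂ (L-nonempty [])

  L-singleton : ∀ u → L [ u ] ≡ ⁅ u ⁆
  L-singleton u = begin
    L [ u ]            ≡⟨ sym (∩-idem (L [ u ])) ⟩
    L [ u ] ∩ L [ u ]  ≡⟨ sym (L-++ x∈[u] x∈[u]) ⟩
    L (u ∷ u ∷ [])     ≡⟨ B u u ⟩
    I u u              ≡⟨ I-refl u ⟩
    ⁅ u ⁆              ∎
    where
    open ≡-Reasoning
    x∈[u] : proj₁ (L-nonempty [ u ]) ∈ L [ u ]
    x∈[u] = proj₂ (L-nonempty [ u ])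

  ∈-rotate : ∀ {u v w x} → x ∈ L (u ∷ v ∷ w ∷ []) → x ∈ L (v ∷ w ∷ u ∷ [])
  ∈-rotate {u} {v} {w} = subst (_ ∈_) (A _ _ (↭-sym (shift u (v ∷ w ∷ []) [])))

  ∉-L-antipode : ∀ u v w y → I w y ≡ ⊤ → u ≢ y → y ∉ L (u ∷ v ∷ w ∷ [])
  ∉-L-antipode u v w y antipodal u≢y y∈ = u≢y (x∈⁅y⁆⇒x≡y y (subst (u ∈_) (L-singleton y) u∈[y]))
    where
    y∈[y] : y ∈ L [ y ]
    y∈[y] = subst (y ∈_) (sym (L-singleton y)) (x∈⁅x⁆ y)
    u∈uv : u ∈ L (u ∷ v ∷ [])
    u∈uv = subst (u ∈_) (sym (B u v)) (∈-I-left u v)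
    u∈wy : u ∈ L (w ∷ y ∷ [])
    u∈wy = subst (u ∈_) (sym (trans (B w y) antipodal)) ∈⊤
    u∈[y] : u ∈ L [ y ]
    u∈[y] = proj₂ (x∈p∩q⁻ _ _ (subst (u ∈_) (L-++ y∈ y∈[y]) (∈-L-++ u∈uv u∈wy)))

  L-triangle : ∀ u v w →
    EquilateralMetricTriangle 2 u v w → EquilateralMetricTriangle 2 v w u → EquilateralMetricTriangle 2 w u v →
    (∀ {x} → x ∈ L (u ∷ v ∷ w ∷ []) → x ≡ u ⊎ x ≡ v ⊎ x ≡ w) →
    L (u ∷ v ∷ w ∷ []) ≡ corners u v w
  L-triangle u v w uvw vwu wuv only-vertices = ⊆-antisym vertices all-vertices
    where
    T : Profile
    T = u ∷ v ∷ w ∷ []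

    vertices : L T ⊆ corners u v w
    vertices x∈ with only-vertices x∈
    ... | inj₁ refl        = x∈p∪q⁺ (inj₁ (x∈⁅x⁆ u))
    ... | inj₂ (inj₁ refl) = x∈p∪q⁺ (inj₂ (x∈p∪q⁺ (inj₁ (x∈⁅x⁆ v))))
    ... | inj₂ (inj₂ refl) = x∈p∪q⁺ (inj₂ (x∈p∪q⁺ (inj₂ (x∈⁅x⁆ w))))

    closed : ∀ {z} → z ∈ L T → z ≡ u ⊎ z ≡ v ⊎ z ≡ w → u ∈ L T × v ∈ L T × w ∈ L T
    closed z∈ (inj₁ refl) = E₂ u v w uvw z∈
    closed z∈ (inj₂ (inj₁ refl)) =
      let v∈ , w∈ , u∈ = E₂ v w u vwu (∈-rotate z∈)
      in ∈-rotate (∈-rotate u∈) , ∈-rotate (∈-rotate v∈) , ∈-rotate (∈-rotate w∈)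
    closed z∈ (inj₂ (inj₂ refl)) =
      let w∈ , u∈ , v∈ = E₂ w u v wuv (∈-rotate (∈-rotate z∈))
      in ∈-rotate u∈ , ∈-rotate v∈ , ∈-rotate w∈

    all-in : u ∈ L T × v ∈ L T × w ∈ L T
    all-in = closed (proj₂ (L-nonempty T)) (only-vertices (proj₂ (L-nonempty T)))

    all-vertices : corners u v w ⊆ L T
    all-vertices x∈ with x∈p∪q⁻ ⁅ u ⁆ _ x∈
    ... | inj₁ x∈u = subst (_∈ L T) (sym (x∈⁅y⁆⇒x≡y u x∈u)) (proj₁ all-in)
    ... | inj₂ x∈vw with x∈p∪q⁻ ⁅ v ⁆ _ x∈vw
    ...   | inj₁ x∈v = subst (_∈ L T) (sym (x∈⁅y⁆⇒x≡y v x∈v)) (proj₁ (proj₂ all-in))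
    ...   | inj₂ x∈w = subst (_∈ L T) (sym (x∈⁅y⁆⇒x≡y w x∈w)) (proj₂ (proj₂ all-in))

  L-even-triangle : L (# 0 ∷ # 2 ∷ # 4 ∷ []) ≡ corners (# 0) (# 2) (# 4)
  L-even-triangle = L-triangle _ _ _ equilateral equilateral equilateral only-vertices
    where
    only-vertices : ∀ {x} → x ∈ L (# 0 ∷ # 2 ∷ # 4 ∷ []) → x ≡ # 0 ⊎ x ≡ # 2 ⊎ x ≡ # 4
    only-vertices {zero}                            _  = inj₁ refl
    only-vertices {suc zero}                        1∈ = ⊥-elim (∉-L-antipode _ _ _ _ refl (λ ()) 1∈)
    only-vertices {suc (suc zero)}                  _  = inj₂ (inj₁ refl)
    only-vertices {suc (suc (suc zero))}            3∈ = ⊥-elim (∉-L-antipode _ _ _ _ refl (λ ()) (∈-rotate 3∈))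
    only-vertices {suc (suc (suc (suc zero)))}      _  = inj₂ (inj₂ refl)
    only-vertices {suc (suc (suc (suc (suc zero))))} 5∈ =
      ⊥-elim (∉-L-antipode _ _ _ _ refl (λ ()) (∈-rotate (∈-rotate 5∈)))

  L-odd-triangle : L (# 1 ∷ # 3 ∷ # 5 ∷ []) ≡ corners (# 1) (# 3) (# 5)
  L-odd-triangle = L-triangle _ _ _ equilateral equilateral equilateral only-vertices
    where
    only-vertices : ∀ {x} → x ∈ L (# 1 ∷ # 3 ∷ # 5 ∷ []) → x ≡ # 1 ⊎ x ≡ # 3 ⊎ x ≡ # 5
    only-vertices {zero}                            0∈ =
      ⊥-elim (∉-L-antipode _ _ _ _ refl (λ ()) (∈-rotate (∈-rotate 0∈)))
    only-vertices {suc zero}                        _  = inj₁ refl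
    only-vertices {suc (suc zero)}                  2∈ = ⊥-elim (∉-L-antipode _ _ _ _ refl (λ ()) 2∈)
    only-vertices {suc (suc (suc zero))}            _  = inj₂ (inj₁ refl)
    only-vertices {suc (suc (suc (suc zero)))}      4∈ = ⊥-elim (∉-L-antipode _ _ _ _ refl (λ ()) (∈-rotate 4∈))
    only-vertices {suc (suc (suc (suc (suc zero))))} _  = inj₂ (inj₂ refl)

data Basic : Profile → Set where
  singleton     : ∀ u → Basic [ u ]
  pair          : ∀ u v → Basic (u ∷ v ∷ [])
  even-triangle : Basic (# 0 ∷ # 2 ∷ # 4 ∷ [])
  odd-triangle  : Basic (# 1 ∷ # 3 ∷ # 5 ∷ [])

Basic-nonempty : ∀ {σ} → Basic σ → 0 < length σ
Basic-nonempty (singleton _) = s≤s z≤n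
Basic-nonempty (pair _ _)    = s≤s z≤n
Basic-nonempty even-triangle = s≤s z≤n
Basic-nonempty odd-triangle  = s≤s z≤n

Basic-agree : ∀ {L L'} → IsConsensus L → ABCE₂ L → IsConsensus L' → ABCE₂ L' →
              ∀ {σ} → Basic σ → L σ ≡ L' σ
Basic-agree {L} {L'} L-nonempty axioms L'-nonempty axioms' = agree
  where
  module ℒ  = Consequences L L-nonempty axioms
  module ℒ' = Consequences L' L'-nonempty axioms'
  agree : ∀ {σ} → Basic σ → L σ ≡ L' σ
  agree (singleton u) = trans (ℒ.L-singleton u) (sym (ℒ'.L-singleton u))
  agree (pair u v)    = trans (ℒ.B u v) (sym (ℒ'.B u v))
  agree even-triangle = trans ℒ.L-even-triangle (sym ℒ'.L-even-triangle)
  agree odd-triangle  = trans ℒ.L-odd-triangle (sym ℒ'.L-odd-triangle)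

F-+-bound : ∀ τ {a b m} → All (λ x → d a x + d b x ≤ 2 * d m x) τ → F τ a + F τ b ≤ 2 * F τ m
F-+-bound []      []       = z≤n
F-+-bound (x ∷ τ) {a} {b} {m} (bound ∷ bounds) = begin
  (d a x + F τ a) + (d b x + F τ b)  ≡⟨ interchange (d a x) (F τ a) (d b x) (F τ b) ⟩
  (d a x + d b x) + (F τ a + F τ b)  ≤⟨ +-mono-≤ bound (F-+-bound τ bounds) ⟩
  2 * d m x + 2 * F τ m              ≡⟨ sym (*-distribˡ-+ 2 (d m x) (F τ m)) ⟩
  2 * (d m x + F τ m)                ∎
  where open ≤-Reasoning

Balanced : Profile → Subset 6 → Set
Balanced σ X = ∀ m → ∃₂ λ a b → a ∈ Med σ × (∀ x → x ∈ X → d a x + d b x ≤ 2 * d m x)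

-- With m a median of τ, F τ a + F τ b ≤ 2 F τ m ≤ F τ m + F τ b forces a to be a median of τ.
Balanced⇒Med-meets : ∀ {σ X τ} → Balanced σ X → All (_∈ X) τ → Nonempty (Med σ ∩ Med τ)
Balanced⇒Med-meets {σ} {X} {τ} balanced τ⊆X = meets (Med-nonempty τ)
  where
  meets : Nonempty (Med τ) → Nonempty (Med σ ∩ Med τ)
  meets (m , m∈) with balanced m
  ... | a , b , a∈σ , dominated = a , x∈p∩q⁺ (a∈σ , ∈Med⁺ τ (λ v → ≤-trans Fa≤Fm (m-median v)))
    where
    open ≤-Reasoning
    m-median : IsMedian τ m
    m-median = ∈Med⁻ τ m∈
    Fa≤Fm : F τ a ≤ F τ m
    Fa≤Fm = +-cancelʳ-≤ (F τ b) (F τ a) (F τ m) (begin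
      F τ a + F τ b      ≤⟨ F-+-bound τ (All.map (dominated _) τ⊆X) ⟩
      2 * F τ m          ≡⟨ cong (F τ m +_) (+-identityʳ (F τ m)) ⟩
      F τ m + F τ m      ≤⟨ +-monoʳ-≤ (F τ m) (m-median b) ⟩
      F τ m + F τ b      ∎)

Fits : Subset 6 → Profile → Set
Fits X σ = Unique σ × All (_∈ X) σ × Balanced σ X

fits? : ∀ X σ → Dec (Fits X σ)
fits? X σ = unique? σ ×-dec All.all? (_∈? X) σ ×-dec
  (all? λ m → any? λ a → any? λ b → (a ∈? Med σ) ×-dec
     all? (λ x → x ∈? X →-dec (d a x + d b x ≤? 2 * d m x)))

basics : List (∃ Basic)
basics = (-, even-triangle) ∷ (-, odd-triangle) ∷
  map (λ (u , v) → -, pair u v) (cartesianProduct (allFin 6) (allFin 6)) ++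
  map (λ u → -, singleton u) (allFin 6)

fitting-basic : ∀ X → Nonempty X → ∃ λ σ → Basic σ × Fits X σ
fitting-basic X X≠∅ =
  let (σ , basic) , fits = satisfied (decidable-stable (Any.any? (fits? X ∘ proj₁) basics)
                                                       (λ none → no-counterexample (X , X≠∅ , none)))
  in σ , basic , fits
  where
  no-counterexample : ¬ ∃ λ X → Nonempty X × ¬ Any.Any (Fits X ∘ proj₁) basics
  no-counterexample = from-no (anySubset? λ X → nonempty? X ×-dec ¬? (Any.any? (fits? X ∘ proj₁) basics))

support : Profile → Subset 6
support π = tabulate (λ v → toSide (does (v ∈ˡ? π)))

∈-support⁺ : ∀ π {v} → v ∈ˡ π → v ∈ support π
∈-support⁺ π = ∈-decided⁺ (_∈ˡ? π)

∈-support⁻ : ∀ π {v} → v ∈ support π → v ∈ˡ π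
∈-support⁻ π = ∈-decided⁻ (_∈ˡ? π)

extract : ∀ {σ π : Profile} → Unique σ → All (_∈ˡ π) σ → ∃ λ τ → π ↭ σ ++ τ
extract {[]}    {π} _ _ = π , ↭-refl
extract {x ∷ σ} (x∉σ ∷ unique) (x∈π ∷ σ⊆π) with ∈-∃++ x∈π
... | h , t , refl =
  let τ , p = extract unique (All.zipWith {P = x ≢_} ∈-remove (x∉σ , σ⊆π))
  in τ , ↭-trans (shift x h t) (prep x p)
  where
  ∈-remove : ∀ {y} → x ≢ y × y ∈ˡ h ++ [ x ] ++ t → y ∈ˡ h ++ t
  ∈-remove (x≢y , y∈) with ∈-resp-↭ (shift x h t) y∈
  ... | here y≡x  = ⊥-elim (x≢y (sym y≡x))
  ... | there y∈′ = y∈′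

support-++ʳ : ∀ {π σ τ} → π ↭ σ ++ τ → All (_∈ support π) τ
support-++ʳ {π} {σ} p = All.tabulate (λ y∈τ → ∈-support⁺ π (∈-resp-↭ (↭-sym p) (∈-++⁺ʳ σ y∈τ)))

decompose : ∀ x xs → ∃₂ λ σ τ → Basic σ × x ∷ xs ↭ σ ++ τ × Nonempty (Med σ ∩ Med τ)
decompose x xs =
  let π = x ∷ xs
      σ , basic , unique , σ⊆π , balanced = fitting-basic (support π) (x , ∈-support⁺ π (here refl))
      τ , π↭σ++τ = extract unique (All.map (∈-support⁻ π) σ⊆π)
  in σ , τ , basic , π↭σ++τ , Balanced⇒Med-meets {σ} {support π} {τ} balanced (support-++ʳ π↭σ++τ)

module Uniqueness (L : ConsensusFn) (L-nonempty : IsConsensus L) (axioms : ABCE₂ L) where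

  open Consequences L L-nonempty axioms using (A; C; L-[])

  agree-++ : ∀ {π σ τ} → π ↭ σ ++ τ → L σ ≡ Med σ → L τ ≡ Med τ → Nonempty (Med σ ∩ Med τ) →
             L π ≡ Med π
  agree-++ {π} {σ} {τ} p Lσ≡Medσ Lτ≡Medτ meet = begin
    L π              ≡⟨ A π (σ ++ τ) p ⟩
    L (σ ++ τ)       ≡⟨ C σ τ (subst Nonempty (sym L∩≡Med∩) meet) ⟩
    L σ ∩ L τ        ≡⟨ L∩≡Med∩ ⟩
    Med σ ∩ Med τ    ≡⟨ sym (Med-C σ τ meet) ⟩
    Med (σ ++ τ)     ≡⟨ sym (Med-A π (σ ++ τ) p) ⟩
    Med π            ∎
    where
    open ≡-Reasoning
    L∩≡Med∩ : L σ ∩ L τ ≡ Med σ ∩ Med τ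
    L∩≡Med∩ = cong₂ _∩_ Lσ≡Medσ Lτ≡Medτ

  agree : ∀ π → Acc (_<_ on length) π → L π ≡ Med π
  agree [] _ = L-[]
  agree (x ∷ xs) (acc shorter) =
    let σ , τ , basic , π↭σ++τ , meet = decompose x xs
        τ<π = subst (length τ <_) (sym (trans (↭-length π↭σ++τ) (length-++ σ)))
                    (m<n+m (length τ) (Basic-nonempty basic))
    in agree-++ π↭σ++τ (Basic-agree L-nonempty axioms Med-nonempty Med-ABCE₂ basic)
                (agree τ (shorter τ<π)) meet

proposition46 : (IsConsensus Med × ABCE₂ Med)
                × (∀ L → IsConsensus L → ABCE₂ L → ∀ π → L π ≡ Med π)
proposition46 = (Med-nonempty , Med-ABCE₂) ,
  λ L L-nonempty axioms π → Uniqueness.agree L L-nonempty axioms π (on-wellFounded length <-wellFounded π)
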